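{- Let $n,p$ be odd and $q$ an integer with $2<\frac{p}{q}<4$. Let $O=k_0k_1\,k_1k_2\,\cdots\,k_{2n-1}k_0$ be a closed walk of length $2n$ in $K_{p/q}$. If $[O]=[R]^{2}$ for some walk $R$ of odd length in $K_{p/q}$, then there is an index $i\in\mathbb{Z}_{2n}$ such that $k_ik_{i+n+1}$ and $k_{i+1}k_{i+n}$ are edges of $K_{p/q}$ (indices taken modulo $2n$).
   Context: The circular clique $K_{p/q}$ has vertex set $\mathbb{Z}_p$ and edges $\{i,i+j\}$ for $i\in\mathbb{Z}_p$, $j\in\{q,\dots,p-q\}$. A walk is a sequence of oriented edges each starting where the previous ends; $WW'$ is concatenation. A square is a quadruple $v_1,\dots,v_4$ with $v_1v_2,v_2v_3,v_3v_4,v_4v_1$ edges. $\sim$ is the smallest equivalence relation on walks such that a walk is equivalent to the result of deleting any consecutive pair $e,e^{ -1}$, and $W\,v_1v_2\,v_2v_3\,W'\sim W\,v_1v_4\,v_4v_3\,W'$ for all walks $W,W'$ and squares. $[W]$ is the class of $W$, with $[W]\cdot[W']=[WW']$ and $[R]^2=[RR]$. -}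

module Defs where

open import Data.Nat using (ℕ; zero; suc; _+_; _*_; _∸_; _≤_; _%_)
open import Data.Nat.DivMod using (_mod_)
open import Data.Fin using (Fin; toℕ)
open import Data.List using (List; []; _∷_; _++_; [_]; length)
open import Data.List.NonEmpty using (List⁺; _∷_; toList; last)
open import Data.List.Relation.Unary.Linked using (Linked)
open import Data.Product using (∃-syntax; _×_)
open import Relation.Binary.PropositionalEquality using (_≡_)
open import Relation.Binary.Construct.Closure.Equivalence using (EqClosure)

Odd : ℕ → Set
Odd n = ∃[ m ] n ≡ suc (2 * m)

diff : ∀ {p} → Fin p → Fin p → ℕ
diff {suc p′} a b = (suc p′ + toℕ b ∸ toℕ a) % suc p′

-- Adjacency in the circular clique K_{p/q} on vertex set Z_p = Fin p:
-- a ~ b iff b = a + j (mod p) for some j ∈ {q, …, p - q}.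
Adj : (p q : ℕ) → Fin p → Fin p → Set
Adj p q a b = (q ≤ diff a b) × (diff a b ≤ p ∸ q)

-- A walk is represented by its sequence of vertices v₀ v₁ … vₘ
-- (the oriented edges being v₀v₁, v₁v₂, …); its length is m.
IsWalk : (p q : ℕ) → List (Fin p) → Set
IsWalk p q = Linked (Adj p q)

walkLength : ∀ {A : Set} → List⁺ A → ℕ
walkLength (_ ∷ vs) = length vs

Closed : ∀ {A : Set} → List⁺ A → Set
Closed (v ∷ vs) = last (v ∷ vs) ≡ v

-- concatenation W W' (meaningful when W ends where W' starts)
_·_ : ∀ {A : Set} → List⁺ A → List⁺ A → List⁺ A
(v ∷ vs) · (_ ∷ ws) = v ∷ (vs ++ ws)

-- the closed walk x₀x₁ x₁x₂ … x_{m-1}x₀ as a vertex sequence x₀ … x_{m-1} x₀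
closeUp : ∀ {A : Set} → List A → List A
closeUp [] = []
closeUp (x ∷ xs) = x ∷ (xs ++ [ x ])

-- elementary moves generating ~ :
--  deleting a consecutive pair e e⁻¹ (vertex pattern a b a ↦ a), and
--  replacing v₁v₂ v₂v₃ by v₁v₄ v₄v₃ for a square v₁v₂v₃v₄.
data Step (p q : ℕ) : List (Fin p) → List (Fin p) → Set where
  cancel : ∀ (W W′ : List (Fin p)) (a b : Fin p) →
           IsWalk p q (W ++ a ∷ b ∷ a ∷ W′) →
           Step p q (W ++ a ∷ b ∷ a ∷ W′) (W ++ a ∷ W′)
  square : ∀ (W W′ : List (Fin p)) (v₁ v₂ v₃ v₄ : Fin p) →
           IsWalk p q (W ++ v₁ ∷ v₂ ∷ v₃ ∷ W′) →
           Adj p q v₃ v₄ → Adj p q v₄ v₁ →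
           Step p q (W ++ v₁ ∷ v₂ ∷ v₃ ∷ W′) (W ++ v₁ ∷ v₄ ∷ v₃ ∷ W′)

Homotopic : (p q : ℕ) → List (Fin p) → List (Fin p) → Set
Homotopic p q = EqClosure (Step p q)

shift : ∀ {N} → Fin N → ℕ → Fin N
shift {suc N′} i j = (toℕ i + j) mod suc N′

module Submission where

-- Give every edge a → b of K_{p/q} the winding σ(a,b) = 2·d(a,b) − p,
-- where d(a,b) ∈ [0,p) is b − a modulo p, and give a walk the sum of the
-- windings of its edges.  Writing p = 2q + s (so 0 ≤ s < 2q because 2 < p/q < 4):
--  (1) ab is an edge iff |σ(a,b)| ≤ s; and |σ(a,b)| ≤ p for all a, b;
--  (2) modulo 2p the winding of a walk is 2·(last − first) − p·(length);
--  (3) hence backtracks and squares, being short closed walks of even length,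
--      have winding 0, so the winding is invariant under ~.  From [O] = [R]²
--      the winding of O is 2C, where C, the winding of the closed walk R of
--      odd length, is ≡ p modulo 2p;
--  (4) a discrete intermediate value argument on the windings Φ(j) of the
--      prefixes k₀ … k_j of O gives i < n such that the stretches of O from
--      k_i to k_{i+n+1} and from k_{i+1} to k_{i+n} both wind C up to ±s;
--  (5) by (2), such a stretch of even length from a to b winds, modulo 2p,
--      like C + σ(a,b); both sides being small, its winding is exactly
--      C + σ(a,b), so |σ(a,b)| ≤ s and ab is an edge by (1).
-- The file develops integer congruences and the intermediate value argument,
-- then windings of walks in Z_p, their homotopy invariance, and finally
-- derives the theorem.

open import Defs
open import Data.Nat using (ℕ; zero; suc; _+_; _*_; _∸_; _≤_; _<_; z≤n; s≤s; NonZero)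
open import Data.Nat.Properties
  using (≤-refl; ≤-reflexive; ≤-trans; <-irrefl; ≤-<-trans; <⇒≤; m≤m*n; m≤m+n; +-mono-≤; +-monoˡ-<;
         m<n+m; m≤n⇒m≤1+n; +-assoc; +-comm; +-identityʳ; m+n∸m≡n; *-monoʳ-≤; *-cancelˡ-≤;
         *-monoʳ-<; +-cancelˡ-<; m≤n⇒∃[o]m+o≡n)
open import Data.Nat.DivMod using (_/_; _mod_; m≡m%n+[m/n]*n; m%n<n; n%n≡0; m<n⇒m%n≡m)
import Data.Nat.Tactic.RingSolver as ℕSolver
open import Data.Integer as ℤ using (ℤ; +_; -[1+_]; 0ℤ; 1ℤ; ∣_∣; +≤+; -≤+; -≤-)
import Data.Integer.Properties as ℤP
import Data.Integer.Tactic.RingSolver as ℤSolver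
open import Data.Fin using (Fin; toℕ; zero)
open import Data.Fin.Properties using (toℕ<n; toℕ-fromℕ<; toℕ-injective)
open import Data.List using (List; []; _∷_; _++_; [_]; length; map; allFin; tabulate; applyUpTo;
                            initLast; _∷ʳ′_)
open import Data.List.Properties using (length-applyUpTo; applyUpTo-∷ʳ; map-tabulate)
open import Data.List.NonEmpty using (List⁺; _∷_; toList; last)
open import Data.List.Relation.Unary.Linked as Linked using (Linked; [-]; _∷_)
open import Data.Product as Product using (∃-syntax; _×_; _,_; proj₁; proj₂)
open import Data.Sum using (_⊎_; inj₁; inj₂)
open import Function using (id; _∘_)
open import Relation.Binary.PropositionalEquality hiding ([_])
open import Relation.Nullary using (contradiction)
open import Relation.Binary.Construct.Closure.Equivalence using (fold)
import Relation.Binary.Construct.On as On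
open ≡-Reasoning

infix 4 _≡_⟨mod_⟩

_≡_⟨mod_⟩ : ℤ → ℤ → ℤ → Set
x ≡ y ⟨mod m ⟩ = ∃[ t ] x ≡ y ℤ.+ m ℤ.* t

m*n<m⇒n≡0 : ∀ m n → m * n < m → n ≡ 0
m*n<m⇒n≡0 m zero    _     = refl
m*n<m⇒n≡0 m (suc n) mn<m = contradiction (≤-<-trans (m≤m*n m (suc n)) mn<m) (<-irrefl refl)

congruent-close : ∀ {x y : ℤ} {M r r′ : ℕ} → x ≡ y ⟨mod + M ⟩ →
                  ∣ x ∣ ≤ r → ∣ y ∣ ≤ r′ → r + r′ < M → x ≡ y
congruent-close {x} {y} {M} (t , x≡y+Mt) ∣x∣≤r ∣y∣≤r′ r+r′<M = begin
  x                  ≡⟨ x≡y+Mt ⟩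
  y ℤ.+ + M ℤ.* t    ≡⟨ cong (λ u → y ℤ.+ + M ℤ.* u) (ℤP.∣i∣≡0⇒i≡0 (m*n<m⇒n≡0 M ∣ t ∣ M∣t∣<M)) ⟩
  y ℤ.+ + M ℤ.* 0ℤ   ≡⟨ drop-zero y (+ M) ⟩
  y                  ∎
  where
  drop-zero : ∀ a b → a ℤ.+ b ℤ.* 0ℤ ≡ a
  drop-zero = ℤSolver.solve-∀
  add-sub : ∀ a b → a ℤ.+ b ℤ.- a ≡ b
  add-sub = ℤSolver.solve-∀
  Mt≡x-y : + M ℤ.* t ≡ x ℤ.- y
  Mt≡x-y = trans (sym (add-sub y (+ M ℤ.* t))) (cong (ℤ._- y) (sym x≡y+Mt))
  M∣t∣<M : M * ∣ t ∣ < M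
  M∣t∣<M = ≤-<-trans
    (≤-trans (≤-reflexive (trans (sym (ℤP.abs-* (+ M) t)) (cong ∣_∣ Mt≡x-y)))
             (≤-trans (ℤP.∣i-j∣≤∣i∣+∣j∣ x y) (+-mono-≤ ∣x∣≤r ∣y∣≤r′)))
    r+r′<M

abs≤⇒bounds : ∀ {x r} → ∣ x ∣ ≤ r → ℤ.- + r ℤ.≤ x × x ℤ.≤ + r
abs≤⇒bounds {+ n}      {zero}  n≤r       = +≤+ z≤n , +≤+ n≤r
abs≤⇒bounds {+ n}      {suc r} n≤r       = -≤+ , +≤+ n≤r
abs≤⇒bounds { -[1+ n ]} {suc r} (s≤s n≤r) = -≤- n≤r , -≤+

bounds⇒abs≤ : ∀ {x r} → ℤ.- + r ℤ.≤ x → x ℤ.≤ + r → ∣ x ∣ ≤ r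
bounds⇒abs≤ {+ n}       _         (+≤+ n≤r) = n≤r
bounds⇒abs≤ { -[1+ n ]} {zero}  ()        _
bounds⇒abs≤ { -[1+ n ]} {suc r} (-≤- n≤r) _ = s≤s n≤r

abs≤-neg : ∀ {x y r} → x ≡ ℤ.- y → ∣ y ∣ ≤ r → ∣ x ∣ ≤ r
abs≤-neg {y = y} refl ∣y∣≤r = subst (_≤ _) (sym (ℤP.∣-i∣≡∣i∣ y)) ∣y∣≤r

SignChange : ℤ → ℤ → Set
SignChange x y = (x ℤ.≤ 0ℤ × 0ℤ ℤ.≤ y) ⊎ (0ℤ ℤ.≤ x × y ℤ.≤ 0ℤ)

sign-change-neg : ∀ x → SignChange x (ℤ.- x)
sign-change-neg x with ℤP.≤-total x 0ℤ
... | inj₁ x≤0 = inj₁ (x≤0 , ℤP.neg-mono-≤ x≤0)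
... | inj₂ 0≤x = inj₂ (0≤x , ℤP.neg-mono-≤ 0≤x)

sign-change : (f : ℕ → ℤ) (L : ℕ) → SignChange (f 0) (f (suc L)) →
              ∃[ i ] (i ≤ L × SignChange (f i) (f (suc i)))
sign-change f zero    change = 0 , z≤n , change
sign-change f (suc L) change with ℤP.≤-total (f (suc L)) 0ℤ | change
... | inj₁ f≤0 | inj₁ (f₀≤0 , 0≤f′) = suc L , ≤-refl , inj₁ (f≤0 , 0≤f′)
... | inj₂ 0≤f | inj₂ (0≤f₀ , f′≤0) = suc L , ≤-refl , inj₂ (0≤f , f′≤0)
... | inj₁ f≤0 | inj₂ (0≤f₀ , _)    =
  Product.map₂ (Product.map₁ m≤n⇒m≤1+n) (sign-change f L (inj₂ (0≤f₀ , f≤0)))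
... | inj₂ 0≤f | inj₁ (f₀≤0 , _)    =
  Product.map₂ (Product.map₁ m≤n⇒m≤1+n) (sign-change f L (inj₁ (f₀≤0 , 0≤f)))

upward-crossing : ∀ {x a b s} → x ℤ.≤ 0ℤ → 0ℤ ℤ.≤ x ℤ.+ a ℤ.- b → ∣ a ∣ ≤ s → ∣ b ∣ ≤ s →
                  ∣ x ℤ.+ a ∣ ≤ s × ∣ x ℤ.- b ∣ ≤ s
upward-crossing {x} {a} {b} {s} x≤0 0≤x+a-b ∣a∣≤s ∣b∣≤s =
    bounds⇒abs≤ (ℤP.≤-trans -s≤b b≤x+a) (ℤP.≤-trans x+a≤a a≤s)
  , bounds⇒abs≤ (ℤP.≤-trans -s≤-a -a≤x-b) (ℤP.≤-trans x-b≤-b -b≤s)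
  where
  a≤s : a ℤ.≤ + s
  a≤s = proj₂ (abs≤⇒bounds ∣a∣≤s)
  -s≤b : ℤ.- + s ℤ.≤ b
  -s≤b = proj₁ (abs≤⇒bounds ∣b∣≤s)
  regroup : ∀ x a b → x ℤ.+ a ℤ.- b ≡ x ℤ.- b ℤ.- ℤ.- a
  regroup = ℤSolver.solve-∀
  b≤x+a : b ℤ.≤ x ℤ.+ a
  b≤x+a = ℤP.0≤i-j⇒j≤i 0≤x+a-b
  -a≤x-b : ℤ.- a ℤ.≤ x ℤ.- b
  -a≤x-b = ℤP.0≤i-j⇒j≤i (subst (0ℤ ℤ.≤_) (regroup x a b) 0≤x+a-b)
  x+a≤a : x ℤ.+ a ℤ.≤ a
  x+a≤a = subst (x ℤ.+ a ℤ.≤_) (ℤP.+-identityˡ a) (ℤP.+-monoˡ-≤ a x≤0)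
  x-b≤-b : x ℤ.- b ℤ.≤ ℤ.- b
  x-b≤-b = subst (x ℤ.- b ℤ.≤_) (ℤP.+-identityˡ (ℤ.- b)) (ℤP.+-monoˡ-≤ (ℤ.- b) x≤0)
  -s≤-a : ℤ.- + s ℤ.≤ ℤ.- a
  -s≤-a = ℤP.neg-mono-≤ a≤s
  -b≤s : ℤ.- b ℤ.≤ + s
  -b≤s = subst (ℤ.- b ℤ.≤_) (ℤP.neg-involutive (+ s)) (ℤP.neg-mono-≤ -s≤b)

-- The same conclusion for a sign change in either direction; the downward
-- case is the upward one for −x, −a, −b.
crossing-bound : ∀ {x a b s} → SignChange x (x ℤ.+ a ℤ.- b) → ∣ a ∣ ≤ s → ∣ b ∣ ≤ s →
                 ∣ x ℤ.+ a ∣ ≤ s × ∣ x ℤ.- b ∣ ≤ s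
crossing-bound (inj₁ (x≤0 , 0≤y)) ∣a∣≤s ∣b∣≤s = upward-crossing x≤0 0≤y ∣a∣≤s ∣b∣≤s
crossing-bound {x} {a} {b} (inj₂ (0≤x , y≤0)) ∣a∣≤s ∣b∣≤s =
  Product.map (abs≤-neg (negate₁ x a)) (abs≤-neg (negate₂ x b))
    (upward-crossing {ℤ.- x} {ℤ.- a} {ℤ.- b} (ℤP.neg-mono-≤ 0≤x)
                     (subst (0ℤ ℤ.≤_) (negate₃ x a b) (ℤP.neg-mono-≤ y≤0))
                     (abs≤-neg {y = a} refl ∣a∣≤s) (abs≤-neg {y = b} refl ∣b∣≤s))
  where
  negate₁ : ∀ x a → x ℤ.+ a ≡ ℤ.- (ℤ.- x ℤ.+ ℤ.- a)
  negate₁ = ℤSolver.solve-∀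
  negate₂ : ∀ x b → x ℤ.- b ≡ ℤ.- (ℤ.- x ℤ.- ℤ.- b)
  negate₂ = ℤSolver.solve-∀
  negate₃ : ∀ x a b → ℤ.- (x ℤ.+ a ℤ.- b) ≡ ℤ.- x ℤ.+ ℤ.- a ℤ.- ℤ.- b
  negate₃ = ℤSolver.solve-∀

balanced-window : (Φ : ℕ → ℤ) (C : ℤ) (s L : ℕ) →
  (∀ j → j < suc L + suc L → ∣ Φ (suc j) ℤ.- Φ j ∣ ≤ s) →
  Φ (suc L + suc L) ℤ.- Φ 0 ≡ C ℤ.+ C →
  ∃[ i ] (i < suc L × ∣ Φ (suc i + suc L) ℤ.- Φ i ℤ.- C ∣ ≤ s
                   × ∣ Φ (i + suc L) ℤ.- Φ (suc i) ℤ.- C ∣ ≤ s)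
balanced-window Φ C s L increment total =
  let i , i≤L , change = sign-change excess L (subst (SignChange (excess 0)) (sym antipodal)
                                                      (sign-change-neg (excess 0)))
      bounds = crossing-bound (subst (SignChange (excess i)) (step i) change)
                              (increment (i + n) (+-monoˡ-< n (s≤s i≤L)))
                              (increment i (≤-trans (s≤s i≤L) (m≤m+n n n)))
  in i , s≤s i≤L
       , subst (λ z → ∣ z ∣ ≤ s) (longer (Φ (suc i + n)) (Φ (i + n)) (Φ i) C) (proj₁ bounds)
       , subst (λ z → ∣ z ∣ ≤ s) (shorter (Φ (i + n)) (Φ (suc i)) (Φ i) C) (proj₂ bounds)
  where
  n = suc L
  excess : ℕ → ℤ
  excess i = Φ (i + n) ℤ.- Φ i ℤ.- C
  step : ∀ i → excess (suc i) ≡ excess i ℤ.+ (Φ (suc i + n) ℤ.- Φ (i + n)) ℤ.- (Φ (suc i) ℤ.- Φ i)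
  step i = slide (Φ (suc i + n)) (Φ (i + n)) (Φ (suc i)) (Φ i) C
    where
    slide : ∀ A B A′ B′ C → A ℤ.- A′ ℤ.- C ≡ B ℤ.- B′ ℤ.- C ℤ.+ (A ℤ.- B) ℤ.- (A′ ℤ.- B′)
    slide = ℤSolver.solve-∀
  antipodal : excess n ≡ ℤ.- excess 0
  antipodal = begin
    excess n                                             ≡⟨ split (Φ (n + n)) (Φ n) (Φ 0) C ⟩
    ℤ.- excess 0 ℤ.+ (Φ (n + n) ℤ.- Φ 0 ℤ.- (C ℤ.+ C))   ≡⟨ cong (λ t → ℤ.- excess 0 ℤ.+ (t ℤ.- (C ℤ.+ C))) total ⟩
    ℤ.- excess 0 ℤ.+ (C ℤ.+ C ℤ.- (C ℤ.+ C))             ≡⟨ vanish (ℤ.- excess 0) (C ℤ.+ C) ⟩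
    ℤ.- excess 0                                         ∎
    where
    split : ∀ A B Z C → A ℤ.- B ℤ.- C ≡ ℤ.- (B ℤ.- Z ℤ.- C) ℤ.+ (A ℤ.- Z ℤ.- (C ℤ.+ C))
    split = ℤSolver.solve-∀
    vanish : ∀ e D → e ℤ.+ (D ℤ.- D) ≡ e
    vanish = ℤSolver.solve-∀
  longer : ∀ A B Z C → B ℤ.- Z ℤ.- C ℤ.+ (A ℤ.- B) ≡ A ℤ.- Z ℤ.- C
  longer = ℤSolver.solve-∀
  shorter : ∀ B A′ Z C → B ℤ.- Z ℤ.- C ℤ.- (A′ ℤ.- Z) ≡ B ℤ.- A′ ℤ.- C
  shorter = ℤSolver.solve-∀

last-∷ : ∀ {A : Set} (x y : A) ys → last (x ∷ y ∷ ys) ≡ last (y ∷ ys)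
last-∷ x y ys with initLast ys
... | []       = refl
... | _ ∷ʳ′ _  = refl

last-applyUpTo : ∀ {A : Set} (f : ℕ → A) j → last (f 0 ∷ applyUpTo (f ∘ suc) j) ≡ f j
last-applyUpTo f zero    = refl
last-applyUpTo f (suc j) = trans (last-∷ (f 0) (f 1) (applyUpTo (f ∘ suc ∘ suc) j)) (last-applyUpTo (f ∘ suc) j)

linked-suffix : ∀ {A : Set} {R : A → A → Set} (W : List A) {xs} → Linked R (W ++ xs) → Linked R xs
linked-suffix []      linked = linked
linked-suffix (_ ∷ W) linked = linked-suffix W (Linked.tail linked)

applyUpTo⁻ : ∀ {A : Set} {R : A → A → Set} (f : ℕ → A) L → Linked R (applyUpTo f (suc L)) →
             ∀ {j} → j < L → R (f j) (f (suc j))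
applyUpTo⁻ f (suc L) linked {zero}  _         = Linked.head linked
applyUpTo⁻ f (suc L) linked {suc j} (s≤s j<L) = applyUpTo⁻ (f ∘ suc) L (Linked.tail linked) j<L

tabulate-applyUpTo : ∀ {A : Set} {N} (g : Fin N → A) (h : ℕ → A) → (∀ i → g i ≡ h (toℕ i)) →
                     tabulate g ≡ applyUpTo h N
tabulate-applyUpTo {N = zero}  g h g≗h = refl
tabulate-applyUpTo {N = suc N} g h g≗h =
  cong₂ _∷_ (g≗h zero) (tabulate-applyUpTo (g ∘ Data.Fin.suc) (h ∘ suc) (g≗h ∘ Data.Fin.suc))

toℕ-mod : ∀ {N} .{{_ : NonZero N}} {i} → i < N → toℕ (i mod N) ≡ i
toℕ-mod i<N = trans (toℕ-fromℕ< _) (m<n⇒m%n≡m i<N)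

shift-mod : ∀ {N} .{{_ : NonZero N}} {i} → i < N → ∀ x → shift (i mod N) x ≡ (i + x) mod N
shift-mod {suc N} i<N x = cong (λ j → (j + x) mod suc N) (toℕ-mod i<N)

closeUp-allFin : ∀ {A : Set} N .{{_ : NonZero N}} (k : Fin N → A) →
                 closeUp (map k (allFin N)) ≡ applyUpTo (λ j → k (j mod N)) (suc N)
closeUp-allFin {A} (suc N′) k = begin
  closeUp (map k (allFin N))      ≡⟨ cong closeUp (trans (map-tabulate id k) (tabulate-applyUpTo k K residues)) ⟩
  applyUpTo K N ++ [ K 0 ]        ≡⟨ cong (λ i → applyUpTo K N ++ [ k i ]) wrap ⟩
  applyUpTo K N ++ [ K N ]        ≡⟨ applyUpTo-∷ʳ K N ⟩
  applyUpTo K (suc N)             ∎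
  where
  N = suc N′
  K : ℕ → A
  K j = k (j mod N)
  residues : ∀ i → k i ≡ K (toℕ i)
  residues i = cong k (sym (toℕ-injective (toℕ-mod {N} (toℕ<n i))))
  wrap : 0 mod N ≡ N mod N
  wrap = toℕ-injective (sym (trans (toℕ-fromℕ< (m%n<n N N)) (n%n≡0 N)))

-- Windings of walks in Z_p, for p = P + 1.
module Circle (P : ℕ) where

  p : ℕ
  p = suc P

  pos : Fin p → ℤ
  pos a = + toℕ a

  diff-lift : (a b : Fin p) → + diff a b ≡ pos b ℤ.- pos a ⟨mod + p ⟩
  diff-lift a b = 1ℤ ℤ.- + (m / p) , (begin
      + diff a b                                  ≡⟨ add-sub (+ diff a b) (+ (m / p) ℤ.* + p) ⟩
      + diff a b ℤ.+ + (m / p) ℤ.* + p ℤ.- + (m / p) ℤ.* + p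
        ≡⟨ cong (ℤ._- + (m / p) ℤ.* + p) (sym division) ⟩
      + m ℤ.- + (m / p) ℤ.* + p                   ≡⟨ cong (ℤ._- + (m / p) ℤ.* + p) unfold-m ⟩
      + p ℤ.+ pos b ℤ.- pos a ℤ.- + (m / p) ℤ.* + p ≡⟨ regroup (+ p) (pos b) (pos a) (+ (m / p)) ⟩
      pos b ℤ.- pos a ℤ.+ + p ℤ.* (1ℤ ℤ.- + (m / p)) ∎)
    where
    m = p + toℕ b ∸ toℕ a
    division : + m ≡ + diff a b ℤ.+ + (m / p) ℤ.* + p
    division = trans (cong +_ (m≡m%n+[m/n]*n m p)) (cong (λ u → + diff a b ℤ.+ u) (ℤP.pos-* (m / p) p))
    unfold-m : + m ≡ + p ℤ.+ pos b ℤ.- pos a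
    unfold-m = trans (sym (ℤP.⊖-≥ a≤p+b)) (sym (ℤP.m-n≡m⊖n (p + toℕ b) (toℕ a)))
      where a≤p+b = ≤-trans (<⇒≤ (toℕ<n a)) (m≤m+n p (toℕ b))
    add-sub : ∀ d e → d ≡ d ℤ.+ e ℤ.- e
    add-sub = ℤSolver.solve-∀
    regroup : ∀ P B A Q → P ℤ.+ B ℤ.- A ℤ.- Q ℤ.* P ≡ B ℤ.- A ℤ.+ P ℤ.* (1ℤ ℤ.- Q)
    regroup = ℤSolver.solve-∀

  stretch : ℕ → ℤ
  stretch x = + (2 * x) ℤ.- + p

  -- stretch is strictly increasing, so it both preserves and reflects ≤.
  stretch-mono : ∀ {x y} → x ≤ y → stretch x ℤ.≤ stretch y
  stretch-mono x≤y = ℤP.+-monoˡ-≤ (ℤ.- + p) (+≤+ (*-monoʳ-≤ 2 x≤y))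

  stretch-cancel : ∀ {x y} → stretch x ℤ.≤ stretch y → x ≤ y
  stretch-cancel {x} {y} sx≤sy =
    *-cancelˡ-≤ 2 (ℤP.drop‿+≤+ (subst₂ ℤ._≤_ (sub-add (+ (2 * x)) (+ p)) (sub-add (+ (2 * y)) (+ p))
                                         (ℤP.+-monoˡ-≤ (+ p) sx≤sy)))
    where
    sub-add : ∀ a b → a ℤ.- b ℤ.+ b ≡ a
    sub-add = ℤSolver.solve-∀

  σ : Fin p → Fin p → ℤ
  σ a b = stretch (diff a b)

  σ-lift : (a b : Fin p) → σ a b ≡ + 2 ℤ.* (pos b ℤ.- pos a) ℤ.- + p ⟨mod + (p + p) ⟩
  σ-lift a b =
    let t , d≡ = diff-lift a b in
    t , (begin
      + (2 * diff a b) ℤ.- + p                          ≡⟨ cong (ℤ._- + p) (ℤP.pos-* 2 (diff a b)) ⟩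
      + 2 ℤ.* + diff a b ℤ.- + p                        ≡⟨ cong (λ d → + 2 ℤ.* d ℤ.- + p) d≡ ⟩
      + 2 ℤ.* (pos b ℤ.- pos a ℤ.+ + p ℤ.* t) ℤ.- + p    ≡⟨ regroup (pos b ℤ.- pos a) (+ p) t ⟩
      + 2 ℤ.* (pos b ℤ.- pos a) ℤ.- + p ℤ.+ + (p + p) ℤ.* t ∎)
    where
    regroup : ∀ D P t → + 2 ℤ.* (D ℤ.+ P ℤ.* t) ℤ.- P ≡ + 2 ℤ.* D ℤ.- P ℤ.+ (P ℤ.+ P) ℤ.* t
    regroup = ℤSolver.solve-∀

  σ-bounded : (a b : Fin p) → ∣ σ a b ∣ ≤ p
  σ-bounded a b = bounds⇒abs≤ {σ a b} (stretch-mono {y = diff a b} z≤n)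
                              (subst (σ a b ℤ.≤_) (double-sub (+ p)) (stretch-mono (<⇒≤ diff<p)))
    where
    diff<p : diff a b < p
    diff<p = m%n<n (p + toℕ b ∸ toℕ a) p
    double-sub : ∀ P → + 2 ℤ.* P ℤ.- P ≡ P
    double-sub = ℤSolver.solve-∀

  wind : List (Fin p) → ℤ
  wind []           = 0ℤ
  wind (x ∷ [])     = 0ℤ
  wind (x ∷ y ∷ ys) = σ x y ℤ.+ wind (y ∷ ys)

  wind-++ : ∀ x xs ys → wind (x ∷ xs ++ ys) ≡ wind (x ∷ xs) ℤ.+ wind (last (x ∷ xs) ∷ ys)
  wind-++ x []       ys = sym (ℤP.+-identityˡ _)
  wind-++ x (y ∷ xs) ys = begin
    σ x y ℤ.+ wind (y ∷ xs ++ ys)                             ≡⟨ cong (λ w → σ x y ℤ.+ w) (wind-++ y xs ys) ⟩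
    σ x y ℤ.+ (wind (y ∷ xs) ℤ.+ wind (last (y ∷ xs) ∷ ys))   ≡⟨ sym (ℤP.+-assoc (σ x y) _ _) ⟩
    wind (x ∷ y ∷ xs) ℤ.+ wind (last (y ∷ xs) ∷ ys)           ≡⟨ cong (λ v → wind (x ∷ y ∷ xs) ℤ.+ wind (v ∷ ys)) (sym (last-∷ x y xs)) ⟩
    wind (x ∷ y ∷ xs) ℤ.+ wind (last (x ∷ y ∷ xs) ∷ ys)       ∎

  wind-context : ∀ W {a xs ys} → wind (a ∷ xs) ≡ wind (a ∷ ys) → wind (W ++ a ∷ xs) ≡ wind (W ++ a ∷ ys)
  wind-context []           same = same
  wind-context (w ∷ [])     same = cong (λ u → σ w _ ℤ.+ u) same
  wind-context (w ∷ w′ ∷ W) same = cong (λ u → σ w w′ ℤ.+ u) (wind-context (w′ ∷ W) same)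

  wind-lift : ∀ x xs → wind (x ∷ xs) ≡ + 2 ℤ.* (pos (last (x ∷ xs)) ℤ.- pos x) ℤ.- + p ℤ.* + length xs
                                      ⟨mod + (p + p) ⟩
  wind-lift x []       = 0ℤ , trivial (pos x) (+ p)
    where
    trivial : ∀ X P → 0ℤ ≡ + 2 ℤ.* (X ℤ.- X) ℤ.- P ℤ.* 0ℤ ℤ.+ (P ℤ.+ P) ℤ.* 0ℤ
    trivial = ℤSolver.solve-∀
  wind-lift x (y ∷ ys) =
    let t , σ≡ = σ-lift x y
        u , w≡ = wind-lift y ys
    in t ℤ.+ u , (begin
      σ x y ℤ.+ wind (y ∷ ys)     ≡⟨ cong₂ ℤ._+_ σ≡ w≡ ⟩
      (+ 2 ℤ.* (pos y ℤ.- pos x) ℤ.- + p ℤ.+ + (p + p) ℤ.* t)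
        ℤ.+ (+ 2 ℤ.* (pos ℓ ℤ.- pos y) ℤ.- + p ℤ.* + length ys ℤ.+ + (p + p) ℤ.* u)
                                  ≡⟨ telescope (pos x) (pos y) (pos ℓ) (+ p) (+ length ys) t u ⟩
      + 2 ℤ.* (pos ℓ ℤ.- pos x) ℤ.- + p ℤ.* (1ℤ ℤ.+ + length ys) ℤ.+ + (p + p) ℤ.* (t ℤ.+ u)
                                  ≡⟨ cong (λ v → + 2 ℤ.* (pos v ℤ.- pos x) ℤ.- + p ℤ.* + length (y ∷ ys)
                                                  ℤ.+ + (p + p) ℤ.* (t ℤ.+ u))
                                          (sym (last-∷ x y ys)) ⟩
      + 2 ℤ.* (pos (last (x ∷ y ∷ ys)) ℤ.- pos x) ℤ.- + p ℤ.* + length (y ∷ ys) ℤ.+ + (p + p) ℤ.* (t ℤ.+ u) ∎)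
    where
    ℓ = last (y ∷ ys)
    telescope : ∀ X Y L P n t u →
      (+ 2 ℤ.* (Y ℤ.- X) ℤ.- P ℤ.+ (P ℤ.+ P) ℤ.* t) ℤ.+ (+ 2 ℤ.* (L ℤ.- Y) ℤ.- P ℤ.* n ℤ.+ (P ℤ.+ P) ℤ.* u)
      ≡ + 2 ℤ.* (L ℤ.- X) ℤ.- P ℤ.* (1ℤ ℤ.+ n) ℤ.+ (P ℤ.+ P) ℤ.* (t ℤ.+ u)
    telescope = ℤSolver.solve-∀

  -- A closed walk of even length winds by a multiple of 2p; so if its
  -- winding is smaller than 2p in absolute value, it is 0.
  closed-even-flat : ∀ {r} x xs h → last (x ∷ xs) ≡ x → length xs ≡ h + h →
                     ∣ wind (x ∷ xs) ∣ ≤ r → r < p + p → wind (x ∷ xs) ≡ 0ℤ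
  closed-even-flat {r} x xs h closed even small r<2p =
    let t , w≡ = wind-lift x xs in
    congruent-close (t ℤ.- + h , (begin
        wind (x ∷ xs)                                            ≡⟨ w≡ ⟩
        + 2 ℤ.* (pos (last (x ∷ xs)) ℤ.- pos x) ℤ.- + p ℤ.* + length xs ℤ.+ + (p + p) ℤ.* t
          ≡⟨ cong₂ (λ v n → + 2 ℤ.* (pos v ℤ.- pos x) ℤ.- + p ℤ.* + n ℤ.+ + (p + p) ℤ.* t) closed even ⟩
        + 2 ℤ.* (pos x ℤ.- pos x) ℤ.- + p ℤ.* (+ h ℤ.+ + h) ℤ.+ + (p + p) ℤ.* t
          ≡⟨ loop (pos x) (+ p) (+ h) t ⟩
        0ℤ ℤ.+ + (p + p) ℤ.* (t ℤ.- + h)                         ∎))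
      small z≤n (subst (_< p + p) (sym (+-identityʳ r)) r<2p)
    where
    loop : ∀ X P H t → + 2 ℤ.* (X ℤ.- X) ℤ.- P ℤ.* (H ℤ.+ H) ℤ.+ (P ℤ.+ P) ℤ.* t ≡ 0ℤ ℤ.+ (P ℤ.+ P) ℤ.* (t ℤ.- H)
    loop = ℤSolver.solve-∀

  closed-odd-wind : (R : List⁺ (Fin p)) → Closed R → Odd (walkLength R) →
                    wind (toList R) ≡ + p ⟨mod + (p + p) ⟩
  closed-odd-wind (v ∷ vs) closed (m , odd) =
    let t , w≡ = wind-lift v vs in
    t ℤ.- + m ℤ.- 1ℤ , (begin
      wind (v ∷ vs)                                             ≡⟨ w≡ ⟩
      + 2 ℤ.* (pos (last (v ∷ vs)) ℤ.- pos v) ℤ.- + p ℤ.* + length vs ℤ.+ + (p + p) ℤ.* t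
        ≡⟨ cong₂ (λ u n → + 2 ℤ.* (pos u ℤ.- pos v) ℤ.- + p ℤ.* + n ℤ.+ + (p + p) ℤ.* t) closed odd ⟩
      + 2 ℤ.* (pos v ℤ.- pos v) ℤ.- + p ℤ.* (1ℤ ℤ.+ + (2 * m)) ℤ.+ + (p + p) ℤ.* t
        ≡⟨ cong (λ k → + 2 ℤ.* (pos v ℤ.- pos v) ℤ.- + p ℤ.* (1ℤ ℤ.+ k) ℤ.+ + (p + p) ℤ.* t) (ℤP.pos-* 2 m) ⟩
      + 2 ℤ.* (pos v ℤ.- pos v) ℤ.- + p ℤ.* (1ℤ ℤ.+ + 2 ℤ.* + m) ℤ.+ + (p + p) ℤ.* t
        ≡⟨ odd-loop (pos v) (+ p) (+ m) t ⟩
      + p ℤ.+ + (p + p) ℤ.* (t ℤ.- + m ℤ.- 1ℤ)                 ∎)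
    where
    odd-loop : ∀ V P M t → + 2 ℤ.* (V ℤ.- V) ℤ.- P ℤ.* (1ℤ ℤ.+ + 2 ℤ.* M) ℤ.+ (P ℤ.+ P) ℤ.* t
                           ≡ P ℤ.+ (P ℤ.+ P) ℤ.* (t ℤ.- M ℤ.- 1ℤ)
    odd-loop = ℤSolver.solve-∀

  wind-twice : (R : List⁺ (Fin p)) → Closed R → wind (toList (R · R)) ≡ wind (toList R) ℤ.+ wind (toList R)
  wind-twice (v ∷ vs) closed = trans (wind-++ v vs vs) (cong (λ u → wind (v ∷ vs) ℤ.+ wind (u ∷ vs)) closed)

  prefix-wind : (ℕ → Fin p) → ℕ → ℤ
  prefix-wind f j = wind (applyUpTo f (suc j))

  prefix-wind-step : ∀ f j → prefix-wind f (suc j) ≡ prefix-wind f j ℤ.+ σ (f j) (f (suc j))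
  prefix-wind-step f j = begin
    wind (applyUpTo f (suc (suc j)))                       ≡⟨ cong wind (sym (applyUpTo-∷ʳ f (suc j))) ⟩
    wind (f 0 ∷ applyUpTo (f ∘ suc) j ++ [ f (suc j) ])    ≡⟨ wind-++ (f 0) (applyUpTo (f ∘ suc) j) [ f (suc j) ] ⟩
    prefix-wind f j ℤ.+ (σ (last (f 0 ∷ applyUpTo (f ∘ suc) j)) (f (suc j)) ℤ.+ 0ℤ)
      ≡⟨ cong (λ v → prefix-wind f j ℤ.+ (σ v (f (suc j)) ℤ.+ 0ℤ)) (last-applyUpTo f j) ⟩
    prefix-wind f j ℤ.+ (σ (f j) (f (suc j)) ℤ.+ 0ℤ)      ≡⟨ cong (λ u → prefix-wind f j ℤ.+ u) (ℤP.+-identityʳ _) ⟩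
    prefix-wind f j ℤ.+ σ (f j) (f (suc j))                ∎

  prefix-wind-lift : ∀ f j → prefix-wind f j ≡ + 2 ℤ.* (pos (f j) ℤ.- pos (f 0)) ℤ.- + p ℤ.* + j ⟨mod + (p + p) ⟩
  prefix-wind-lift f j =
    let t , w≡ = wind-lift (f 0) (applyUpTo (f ∘ suc) j) in
    t , trans w≡ (cong₂ (λ v n → + 2 ℤ.* (pos v ℤ.- pos (f 0)) ℤ.- + p ℤ.* + n ℤ.+ + (p + p) ℤ.* t)
                        (last-applyUpTo f j) (length-applyUpTo (f ∘ suc) j))

  segment-wind : ∀ f a h → prefix-wind f (a + (h + h)) ℤ.- prefix-wind f a
                           ≡ + 2 ℤ.* (pos (f (a + (h + h))) ℤ.- pos (f a)) ⟨mod + (p + p) ⟩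
  segment-wind f a h =
    let t , Φb≡ = prefix-wind-lift f (a + (h + h))
        u , Φa≡ = prefix-wind-lift f a
    in t ℤ.- u ℤ.- + h , (begin
      prefix-wind f (a + (h + h)) ℤ.- prefix-wind f a       ≡⟨ cong₂ ℤ._-_ Φb≡ Φa≡ ⟩
      (+ 2 ℤ.* (pos (f (a + (h + h))) ℤ.- pos (f 0)) ℤ.- + p ℤ.* (+ a ℤ.+ (+ h ℤ.+ + h)) ℤ.+ + (p + p) ℤ.* t)
        ℤ.- (+ 2 ℤ.* (pos (f a) ℤ.- pos (f 0)) ℤ.- + p ℤ.* + a ℤ.+ + (p + p) ℤ.* u)
        ≡⟨ difference (pos (f (a + (h + h)))) (pos (f a)) (pos (f 0)) (+ p) (+ a) (+ h) t u ⟩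
      + 2 ℤ.* (pos (f (a + (h + h))) ℤ.- pos (f a)) ℤ.+ + (p + p) ℤ.* (t ℤ.- u ℤ.- + h) ∎)
    where
    difference : ∀ B A F P a h t u →
      (+ 2 ℤ.* (B ℤ.- F) ℤ.- P ℤ.* (a ℤ.+ (h ℤ.+ h)) ℤ.+ (P ℤ.+ P) ℤ.* t) ℤ.- (+ 2 ℤ.* (A ℤ.- F) ℤ.- P ℤ.* a ℤ.+ (P ℤ.+ P) ℤ.* u)
      ≡ + 2 ℤ.* (B ℤ.- A) ℤ.+ (P ℤ.+ P) ℤ.* (t ℤ.- u ℤ.- h)
    difference = ℤSolver.solve-∀

-- Walks in K_{p/q} for p = 2q + s with q > 0 and s < 2q, i.e. 2 ≤ p/q < 4.
module Homotopy (q′ s : ℕ) (s<2q : s < suc q′ + suc q′) where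

  q : ℕ
  q = suc q′

  open Circle (q′ + q + s) public

  -- s < p as q > 0; this makes s + p < 2p.
  s<p : s < p
  s<p = m<n+m s (s≤s z≤n)

  -- The bounds q ≤ d ≤ p − q of an edge, stretched, are −s and s.
  stretch-q : stretch q ≡ ℤ.- + s
  stretch-q = trans (cong (ℤ._- + p) (ℤP.pos-* 2 q)) (excess (+ q) (+ s))
    where
    excess : ∀ Q S → + 2 ℤ.* Q ℤ.- (Q ℤ.+ Q ℤ.+ S) ≡ ℤ.- S
    excess = ℤSolver.solve-∀

  stretch-p∸q : stretch (p ∸ q) ≡ + s
  stretch-p∸q = begin
    stretch (p ∸ q)                   ≡⟨ cong (λ x → stretch (x ∸ q)) (+-assoc q q s) ⟩
    stretch (q + (q + s) ∸ q)         ≡⟨ cong stretch (m+n∸m≡n q (q + s)) ⟩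
    + (2 * (q + s)) ℤ.- + p           ≡⟨ cong (ℤ._- + p) (ℤP.pos-* 2 (q + s)) ⟩
    + 2 ℤ.* (+ q ℤ.+ + s) ℤ.- + p     ≡⟨ deficit (+ q) (+ s) ⟩
    + s                               ∎
    where
    deficit : ∀ Q S → + 2 ℤ.* (Q ℤ.+ S) ℤ.- (Q ℤ.+ Q ℤ.+ S) ≡ S
    deficit = ℤSolver.solve-∀

  adj⇒bounded : ∀ {a b} → Adj p q a b → ∣ σ a b ∣ ≤ s
  adj⇒bounded {a} {b} (q≤d , d≤p∸q) =
    bounds⇒abs≤ {σ a b} (subst (ℤ._≤ σ a b) stretch-q (stretch-mono q≤d))
                        (subst (σ a b ℤ.≤_) stretch-p∸q (stretch-mono d≤p∸q))

  bounded⇒adj : ∀ {a b} → ∣ σ a b ∣ ≤ s → Adj p q a b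
  bounded⇒adj {a} {b} small =
      stretch-cancel (subst (ℤ._≤ σ a b) (sym stretch-q) (proj₁ (abs≤⇒bounds small)))
    , stretch-cancel (subst (σ a b ℤ.≤_) (sym stretch-p∸q) (proj₂ (abs≤⇒bounds small)))

  wind-bounded : ∀ x xs → IsWalk p q (x ∷ xs) → ∣ wind (x ∷ xs) ∣ ≤ length xs * s
  wind-bounded x []       _    = z≤n
  wind-bounded x (y ∷ ys) walk =
    ≤-trans (ℤP.∣i+j∣≤∣i∣+∣j∣ (σ x y) (wind (y ∷ ys)))
            (+-mono-≤ (adj⇒bounded {x} {y} (Linked.head walk)) (wind-bounded y ys (Linked.tail walk)))

  σ-antisym : ∀ {a b} → Adj p q a b → σ a b ℤ.+ σ b a ≡ 0ℤ
  σ-antisym {a} {b} ab =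
    trans (cong (λ u → σ a b ℤ.+ u) (sym (ℤP.+-identityʳ (σ b a))))
          (closed-even-flat a (b ∷ a ∷ []) 1 refl refl small (+-monoˡ-< p s<p))
    where
    small : ∣ wind (a ∷ b ∷ a ∷ []) ∣ ≤ s + p
    small = ≤-trans (ℤP.∣i+j∣≤∣i∣+∣j∣ (σ a b) (σ b a ℤ.+ 0ℤ))
                    (+-mono-≤ (adj⇒bounded {a} {b} ab)
                              (subst (_≤ p) (cong ∣_∣ (sym (ℤP.+-identityʳ (σ b a)))) (σ-bounded b a)))

  -- The two ways around a square wind equally; this is where p < 4q is needed.
  σ-square : ∀ {v₁ v₂ v₃ v₄} → Adj p q v₁ v₂ → Adj p q v₂ v₃ → Adj p q v₃ v₄ → Adj p q v₄ v₁ →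
             σ v₁ v₂ ℤ.+ σ v₂ v₃ ≡ σ v₁ v₄ ℤ.+ σ v₄ v₃
  σ-square {v₁} {v₂} {v₃} {v₄} a₁₂ a₂₃ a₃₄ a₄₁ = begin
    σ v₁ v₂ ℤ.+ σ v₂ v₃                                        ≡⟨ unwind (σ v₁ v₂) (σ v₂ v₃) (σ v₃ v₄) (σ v₄ v₁) ⟩
    wind (v₁ ∷ v₂ ∷ v₃ ∷ v₄ ∷ v₁ ∷ []) ℤ.- σ v₃ v₄ ℤ.- σ v₄ v₁ ≡⟨ cong (λ w → w ℤ.- σ v₃ v₄ ℤ.- σ v₄ v₁) flat ⟩
    0ℤ ℤ.+ 0ℤ ℤ.- σ v₃ v₄ ℤ.- σ v₄ v₁
      ≡⟨ cong₂ (λ u v → u ℤ.+ v ℤ.- σ v₃ v₄ ℤ.- σ v₄ v₁) (sym (σ-antisym {v₄} {v₁} a₄₁)) (sym (σ-antisym {v₃} {v₄} a₃₄)) ⟩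
    σ v₄ v₁ ℤ.+ σ v₁ v₄ ℤ.+ (σ v₃ v₄ ℤ.+ σ v₄ v₃) ℤ.- σ v₃ v₄ ℤ.- σ v₄ v₁
      ≡⟨ collect (σ v₄ v₁) (σ v₁ v₄) (σ v₃ v₄) (σ v₄ v₃) ⟩
    σ v₁ v₄ ℤ.+ σ v₄ v₃                                        ∎
    where
    unwind : ∀ a b c d → a ℤ.+ b ≡ a ℤ.+ (b ℤ.+ (c ℤ.+ (d ℤ.+ 0ℤ))) ℤ.- c ℤ.- d
    unwind = ℤSolver.solve-∀
    collect : ∀ a b c d → a ℤ.+ b ℤ.+ (c ℤ.+ d) ℤ.- c ℤ.- a ≡ b ℤ.+ d
    collect = ℤSolver.solve-∀
    4s<2p : 4 * s < p + p
    4s<2p = subst₂ _<_ (quadruple s) (double q s) (+-monoˡ-< (2 * s) (*-monoʳ-< 2 s<2q))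
      where
      quadruple : ∀ s → 2 * s + 2 * s ≡ 4 * s
      quadruple = ℕSolver.solve-∀
      double : ∀ q s → 2 * (q + q) + 2 * s ≡ q + q + s + (q + q + s)
      double = ℕSolver.solve-∀
    flat : wind (v₁ ∷ v₂ ∷ v₃ ∷ v₄ ∷ v₁ ∷ []) ≡ 0ℤ
    flat = closed-even-flat v₁ (v₂ ∷ v₃ ∷ v₄ ∷ v₁ ∷ []) 2 refl refl
             (wind-bounded v₁ _ (a₁₂ ∷ a₂₃ ∷ a₃₄ ∷ a₄₁ ∷ [-])) 4s<2p

  step-wind : ∀ {xs ys} → Step p q xs ys → wind xs ≡ wind ys
  step-wind (cancel W W′ a b walk) = wind-context W (begin
    σ a b ℤ.+ (σ b a ℤ.+ wind (a ∷ W′))   ≡⟨ sym (ℤP.+-assoc (σ a b) (σ b a) _) ⟩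
    σ a b ℤ.+ σ b a ℤ.+ wind (a ∷ W′)     ≡⟨ cong (ℤ._+ wind (a ∷ W′)) (σ-antisym {a} {b} (Linked.head (linked-suffix W walk))) ⟩
    0ℤ ℤ.+ wind (a ∷ W′)                  ≡⟨ ℤP.+-identityˡ _ ⟩
    wind (a ∷ W′)                         ∎)
  step-wind (square W W′ v₁ v₂ v₃ v₄ walk a₃₄ a₄₁) = wind-context W (begin
    σ v₁ v₂ ℤ.+ (σ v₂ v₃ ℤ.+ wind (v₃ ∷ W′))   ≡⟨ sym (ℤP.+-assoc (σ v₁ v₂) (σ v₂ v₃) _) ⟩
    σ v₁ v₂ ℤ.+ σ v₂ v₃ ℤ.+ wind (v₃ ∷ W′)     ≡⟨ cong (ℤ._+ wind (v₃ ∷ W′)) (σ-square {v₁} {v₂} {v₃} {v₄} a₁₂ a₂₃ a₃₄ a₄₁) ⟩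
    σ v₁ v₄ ℤ.+ σ v₄ v₃ ℤ.+ wind (v₃ ∷ W′)     ≡⟨ ℤP.+-assoc (σ v₁ v₄) (σ v₄ v₃) _ ⟩
    σ v₁ v₄ ℤ.+ (σ v₄ v₃ ℤ.+ wind (v₃ ∷ W′))   ∎)
    where
    a₁₂ = Linked.head (linked-suffix W walk)
    a₂₃ = Linked.head (Linked.tail (linked-suffix W walk))

  homotopic-wind : ∀ {xs ys} → Homotopic p q xs ys → wind xs ≡ wind ys
  homotopic-wind = fold (On.isEquivalence wind isEquivalence) step-wind

  -- A stretch f a … f b of even length of a walk, winding by C ± s for an odd
  -- multiple C of p, has endpoints joined by an edge of K_{p/q}: its winding
  -- minus C is ≡ σ(f a, f b) modulo 2p, and both are too small to differ.
  chord : (f : ℕ → Fin p) (C : ℤ) → C ≡ + p ⟨mod + (p + p) ⟩ → ∀ a h →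
          ∣ prefix-wind f (a + (h + h)) ℤ.- prefix-wind f a ℤ.- C ∣ ≤ s → Adj p q (f a) (f (a + (h + h)))
  chord f C C-odd a h small =
    bounded⇒adj {f a} {f b} (subst (λ z → ∣ z ∣ ≤ s) (congruent-close {x = prefix-wind f b ℤ.- prefix-wind f a ℤ.- C} {y = σ (f a) (f b)} congruence small (σ-bounded (f a) (f b)) s+p<2p) small)
    where
    b = a + (h + h)
    s+p<2p : s + p < p + p
    s+p<2p = +-monoˡ-< p s<p
    congruence : prefix-wind f b ℤ.- prefix-wind f a ℤ.- C ≡ σ (f a) (f b) ⟨mod + (p + p) ⟩
    congruence =
      let t , Δ≡ = segment-wind f a h
          u , C≡ = C-odd
          v , σ≡ = σ-lift (f a) (f b)
          D = pos (f b) ℤ.- pos (f a)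
      in t ℤ.- u ℤ.- v , (begin
        prefix-wind f b ℤ.- prefix-wind f a ℤ.- C              ≡⟨ cong₂ ℤ._-_ Δ≡ C≡ ⟩
        + 2 ℤ.* D ℤ.+ + (p + p) ℤ.* t ℤ.- (+ p ℤ.+ + (p + p) ℤ.* u)
                                                               ≡⟨ rearrange D (+ p) t u v ⟩
        + 2 ℤ.* D ℤ.- + p ℤ.+ + (p + p) ℤ.* v ℤ.+ + (p + p) ℤ.* (t ℤ.- u ℤ.- v)
                                                               ≡⟨ cong (ℤ._+ + (p + p) ℤ.* (t ℤ.- u ℤ.- v)) (sym σ≡) ⟩
        σ (f a) (f b) ℤ.+ + (p + p) ℤ.* (t ℤ.- u ℤ.- v)         ∎)
      where
      rearrange : ∀ D P t u v → + 2 ℤ.* D ℤ.+ (P ℤ.+ P) ℤ.* t ℤ.- (P ℤ.+ (P ℤ.+ P) ℤ.* u)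
                                ≡ + 2 ℤ.* D ℤ.- P ℤ.+ (P ℤ.+ P) ℤ.* v ℤ.+ (P ℤ.+ P) ℤ.* (t ℤ.- u ℤ.- v)
      rearrange = ℤSolver.solve-∀

  module ClosedWalk (m : ℕ) (k : Fin (2 * suc (2 * m)) → Fin p) where

    n N : ℕ
    n = suc (2 * m)
    N = 2 * n

    K : ℕ → Fin p
    K j = k (j mod N)

    Φ : ℕ → ℤ
    Φ = prefix-wind K

    O : List (Fin p)
    O = closeUp (map k (allFin N))

    N≡n+n : N ≡ n + n
    N≡n+n = cong (λ x → n + x) (+-identityʳ n)

    increment : IsWalk p q O → ∀ j → j < n + n → ∣ Φ (suc j) ℤ.- Φ j ∣ ≤ s
    increment O-walk j j<2n = subst (λ z → ∣ z ∣ ≤ s) (sym edge) (adj⇒bounded {K j} {K (suc j)} O-edge)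
      where
      O-edge = applyUpTo⁻ K N (subst (IsWalk p q) (closeUp-allFin N k) O-walk) (subst (j <_) (sym N≡n+n) j<2n)
      add-sub : ∀ x y → x ℤ.+ y ℤ.- x ≡ y
      add-sub = ℤSolver.solve-∀
      edge : Φ (suc j) ℤ.- Φ j ≡ σ (K j) (K (suc j))
      edge = trans (cong (ℤ._- Φ j) (prefix-wind-step K j)) (add-sub (Φ j) _)

    total : ∀ {C} → wind O ≡ C ℤ.+ C → Φ (n + n) ℤ.- Φ 0 ≡ C ℤ.+ C
    total {C} O-winding = begin
      Φ (n + n) ℤ.- 0ℤ          ≡⟨ ℤP.+-identityʳ (Φ (n + n)) ⟩
      Φ (n + n)                 ≡⟨ cong Φ (sym N≡n+n) ⟩
      wind (applyUpTo K (suc N)) ≡⟨ cong wind (sym (closeUp-allFin N k)) ⟩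
      wind O                    ≡⟨ O-winding ⟩
      C ℤ.+ C                   ∎

    residue : ∀ {i} → i < n → ∀ x {j} → i + x ≡ j → k (shift (i mod N) x) ≡ K j
    residue i<n x i+x≡j =
      cong k (trans (shift-mod (≤-trans i<n (≤-trans (m≤m+n n n) (≤-reflexive (sym N≡n+n)))) x)
                    (cong (_mod N) i+x≡j))

    chords-at : ∀ {C} → C ≡ + p ⟨mod + (p + p) ⟩ → ∀ {i} → i < n →
                ∣ Φ (suc i + n) ℤ.- Φ i ℤ.- C ∣ ≤ s → ∣ Φ (i + n) ℤ.- Φ (suc i) ℤ.- C ∣ ≤ s →
                Adj p q (k (i mod N)) (k (shift (i mod N) (n + 1))) ×
                Adj p q (k (shift (i mod N) 1)) (k (shift (i mod N) n))
    chords-at {C} C-odd {i} i<n long short =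
        subst (Adj p q (K i)) (sym (residue i<n (n + 1) (cong (λ x → i + x) (n+1≡h+h m))))
              (chord K C C-odd i (suc m) (subst (λ j → ∣ Φ j ℤ.- Φ i ℤ.- C ∣ ≤ s) (long-end i m) long))
      , subst₂ (Adj p q) (sym (residue i<n 1 (+-comm i 1))) (sym (residue i<n n (short-end i m)))
              (chord K C C-odd (suc i) m (subst (λ j → ∣ Φ j ℤ.- Φ (suc i) ℤ.- C ∣ ≤ s) (short-end i m) short))
      where
      n+1≡h+h : ∀ m → suc (2 * m) + 1 ≡ suc m + suc m
      n+1≡h+h = ℕSolver.solve-∀
      long-end : ∀ i m → suc i + suc (2 * m) ≡ i + (suc m + suc m)
      long-end = ℕSolver.solve-∀
      short-end : ∀ i m → i + suc (2 * m) ≡ suc i + (m + m)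
      short-end = ℕSolver.solve-∀

  opposite-chords : (n : ℕ) → Odd n → (k : Fin (2 * n) → Fin p) →
    IsWalk p q (closeUp (map k (allFin (2 * n)))) →
    (C : ℤ) → C ≡ + p ⟨mod + (p + p) ⟩ → wind (closeUp (map k (allFin (2 * n)))) ≡ C ℤ.+ C →
    ∃[ i ] (Adj p q (k i) (k (shift i (n + 1))) × Adj p q (k (shift i 1)) (k (shift i n)))
  opposite-chords .(suc (2 * m)) (m , refl) k O-walk C C-odd O-winding =
    let i , i<n , long , short = balanced-window Φ C s (2 * m) (increment O-walk) (total {C} O-winding)
    in i mod N , chords-at C-odd i<n long short
    where open ClosedWalk m k

decompose : ∀ {p q} → 2 * q < p → p < 4 * q →
            ∃[ q′ ] ∃[ s ] (q ≡ suc q′ × p ≡ suc q′ + suc q′ + s × s < suc q′ + suc q′)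
decompose {q = zero} _ ()
decompose {p} {suc q′} 2q<p p<4q =
  let s , 2q+s≡p = m≤n⇒∃[o]m+o≡n (<⇒≤ 2q<p)
      p≡ = trans (sym 2q+s≡p) (twice (suc q′) s)
  in q′ , s , refl , p≡ , +-cancelˡ-< (q + q) s (q + q) (subst₂ _<_ p≡ (quadruple q) p<4q)
  where
  q = suc q′
  twice : ∀ q s → 2 * q + s ≡ q + q + s
  twice = ℕSolver.solve-∀
  quadruple : ∀ q → 4 * q ≡ q + q + (q + q)
  quadruple = ℕSolver.solve-∀

lemma10 : (n p q : ℕ) → Odd n → Odd p → 2 * q < p → p < 4 * q →
          (k : Fin (2 * n) → Fin p) →
          IsWalk p q (closeUp (map k (allFin (2 * n)))) →
          (R : List⁺ (Fin p)) → IsWalk p q (toList R) → Closed R → Odd (walkLength R) →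
          Homotopic p q (closeUp (map k (allFin (2 * n)))) (toList (R · R)) →
          ∃[ i ] (Adj p q (k i) (k (shift i (n + 1))) × Adj p q (k (shift i 1)) (k (shift i n)))
lemma10 n p q n-odd _ 2q<p p<4q k O-walk R _ R-closed R-odd O~RR with decompose {p} {q} 2q<p p<4q
... | q′ , s , refl , refl , s<2q =
  let open Homotopy q′ s s<2q in
  opposite-chords n n-odd k O-walk (wind (toList R)) (closed-odd-wind R R-closed R-odd)
                  (trans (homotopic-wind O~RR) (wind-twice R R-closed))
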